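{- Let $\ell\ge 3$ and $n_1,n_2\ge \ell+2$. Let $\mathscr{G}=\mathscr{G}_{n_1,n_2}^{\ell}$ be the bipartite graph with parts $V_1,V_2$, $|V_1|=n_1$, $|V_2|=n_2$, defined as follows: for $i=1,2$ let $A_i\subseteq V_i$ with $|A_i|=n_i-\ell$ and $B_i=V_i\setminus A_i$; fix distinct $x_1,x_2\in B_1$ and $y_1\in B_2$. The edge set of $\mathscr{G}$ consists exactly of: all edges $uy_1$ with $u\in A_1$; all edges $vx_1$ with $v\in A_2$; the edge $y_1x_2$; and all edges $uv$ with $u\in B_1$, $v\in B_2\setminus\{y_1\}$. Then $\mathscr{G}$ is $C_{2\ell}$-saturated relative to $K_{n_1,n_2}$ (with parts $V_1,V_2$).
   Context: All graphs are finite, simple and undirected. $K_{n_1,n_2}$ is the complete bipartite graph with parts of sizes $n_1,n_2$. $C_r$ is the cycle on $r$ vertices. A spanning subgraph $H$ of $G$ is $F$-saturated relative to $G$ if $H$ contains no copy of $F$ but $H+e$ contains a copy of $F$ for every $e\in E(G)\setminus E(H)$. -}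

module Defs where

open import Data.Nat using (ℕ; zero; suc; _*_; _∸_; _%_)
open import Data.Nat.DivMod using (m%n<n)
open import Data.Fin using (Fin; toℕ; fromℕ<)
open import Data.Fin.Subset using (Subset; _∈_; _∉_)
open import Data.Sum using (_⊎_; inj₁; inj₂)
open import Data.Product using (Σ; _×_)
open import Data.Empty using (⊥)
open import Relation.Nullary using (¬_)
open import Relation.Binary.PropositionalEquality using (_≡_; _≢_)
open import Function.Definitions using (Injective)

cycSucc : ∀ {r} → Fin r → Fin r
cycSucc {suc k} i = fromℕ< (m%n<n (suc (toℕ i)) (suc k))

HasCycle : ℕ → {V : Set} → (V → V → Set) → Set
HasCycle r {V} Adj =
  Σ (Fin r → V) λ f → Injective _≡_ _≡_ f × (∀ i → Adj (f i) (f (cycSucc i)))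

-- Spanning subgraphs of K_{n1,n2} with parts V1 = Fin n1, V2 = Fin n2
-- are given by their edge relation E : Fin n1 → Fin n2 → Set.
-- Vertex set of K_{n1,n2}:
Vtx : ℕ → ℕ → Set
Vtx n₁ n₂ = Fin n₁ ⊎ Fin n₂

BAdj : ∀ {n₁ n₂} → (Fin n₁ → Fin n₂ → Set) → Vtx n₁ n₂ → Vtx n₁ n₂ → Set
BAdj E (inj₁ u) (inj₂ v) = E u v
BAdj E (inj₂ v) (inj₁ u) = E u v
BAdj E (inj₁ _) (inj₁ _) = ⊥
BAdj E (inj₂ _) (inj₂ _) = ⊥

addEdge : ∀ {n₁ n₂} → (Fin n₁ → Fin n₂ → Set) → Fin n₁ → Fin n₂ → Fin n₁ → Fin n₂ → Set
addEdge E u v u' v' = E u' v' ⊎ (u' ≡ u × v' ≡ v)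

CycleSaturatedInK : (r : ℕ) → ∀ {n₁ n₂} → (Fin n₁ → Fin n₂ → Set) → Set
CycleSaturatedInK r E =
  (¬ HasCycle r (BAdj E)) ×
  (∀ u v → ¬ E u v → HasCycle r (BAdj (addEdge E u v)))

𝒢 : ∀ {n₁ n₂} → (A₁ : Subset n₁) (A₂ : Subset n₂) (x₁ x₂ : Fin n₁) (y₁ : Fin n₂)
    → Fin n₁ → Fin n₂ → Set
𝒢 A₁ A₂ x₁ x₂ y₁ u v =
  (u ∈ A₁ × v ≡ y₁) ⊎
  (v ∈ A₂ × u ≡ x₁) ⊎
  (u ≡ x₂ × v ≡ y₁) ⊎
  (u ∉ A₁ × v ∉ A₂ × v ≢ y₁)

-- Every vertex of A₁ has y₁ as its only neighbour and every vertex of A₂ has x₁, so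
-- no cycle meets A₁ ∪ A₂; then y₁, whose only other neighbour is x₂, is pendant as
-- well. A cycle of 𝒢 therefore lies in B₁ ∪ (B₂ ∖ {y₁}), where B_i is the
-- complement of A_i; but a 2ℓ-cycle has ℓ vertices on each side and B₂ ∖ {y₁} has
-- only ℓ − 1.
--
-- Conversely B₁ × (B₂ ∖ {y₁}) is complete bipartite, so a 2ℓ-cycle through a new
-- edge uv is closed by a path alternating between B₁ and B₂ ∖ {y₁}, entered through
-- the edges x₂y₁, y₁u when u ∈ A₁, and through a neighbour a ∈ {x₁, x₂} of v when
-- u ∈ B₁.

module Submission where

open import Defs
open import Data.Nat
  using (ℕ; zero; suc; _+_; _*_; _∸_; _%_; _≤_; _<_; z≤n; s≤s; s≤s⁻¹; ⌊_/2⌋; _<?_)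
open import Data.Nat.Properties
  using (≤-reflexive; ≤-trans; <⇒≤; <-irrefl; <⇒≢; 1+n≰n; n<1+n; n≤1+n; m≤n+m;
         m<n⇒m<1+n; m≤n⇒m<n∨m≡n; m+n≤o⇒m≤o; m∸[m∸n]≡n; +-identityʳ; +-suc;
         +-mono-≤; +-monoʳ-<; ⌊n/2⌋-mono; n≡⌊n+n/2⌋; n≡⌈n+n/2⌉)
open import Data.Nat.DivMod using (m<n⇒m%n≡m; n%n≡0)
open import Data.Fin as Fin using (Fin; toℕ; fromℕ; fromℕ<; inject₁; inject≤)
open import Data.Fin.Properties
  using (toℕ-fromℕ<; toℕ-fromℕ; toℕ-inject₁; toℕ-injective; toℕ<n; fromℕ<-injective;
         fromℕ-def; suc-injective; inject≤-injective; injective⇒≤)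
open import Data.Fin.Subset using (Subset; ∣_∣; _∈_; _∉_; _⊆_; _-_; ∁; ⁅_⁆; inside; outside)
open import Data.Fin.Subset.Properties
  using (p─q⊆p; p─⊥≡p; x∈p∧x≢y⇒x∈p-y; x∉p⇒x∈∁p; x∈∁p⇒x∉p; ∣∁p∣≡n∸∣p∣; _∈?_)
open import Data.Vec.Base using ([]; _∷_; here; there)
open import Data.Vec.Functional using () renaming (_∷_ to _∷ᶠ_)
open import Data.Sum using (_⊎_; inj₁; inj₂; [_,_]′)
open import Data.Sum.Properties using (inj₁-injective; inj₂-injective)
open import Data.Product using (Σ; ∃-syntax; _×_; _,_; proj₁; proj₂)
open import Data.Empty using (⊥; ⊥-elim)
open import Function using (_∘_; id)
open import Function.Definitions using (Injective)
open import Relation.Binary.Definitions using (Symmetric)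
open import Relation.Binary.PropositionalEquality
open import Relation.Nullary using (¬_; yes; no; contradiction)

InjectiveOn : ∀ {A : Set} → ℕ → (ℕ → A) → Set
InjectiveOn k f = ∀ {i j} → i < k → j < k → f i ≡ f j → i ≡ j

extend : ∀ {A : Set} {k} → (Fin (suc k) → A) → ℕ → A
extend {k = k} f m with m <? suc k
... | yes m<1+k = f (fromℕ< m<1+k)
... | no _      = f Fin.zero

extend-< : ∀ {A : Set} {k} (f : Fin (suc k) → A) {m} (m<1+k : m < suc k) →
  extend f m ≡ f (fromℕ< m<1+k)
extend-< {k = k} f {m} m<1+k with m <? suc k
... | yes _  = refl
... | no m≮ = ⊥-elim (m≮ m<1+k)

extend-injectiveOn : ∀ {A : Set} {k} {f : Fin (suc k) → A} →
  Injective _≡_ _≡_ f → InjectiveOn (suc k) (extend f)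
extend-injectiveOn {f = f} f-inj {i} {j} i< j< eq =
  fromℕ<-injective i j i< j< (f-inj (trans (sym (extend-< f i<)) (trans eq (extend-< f j<))))

inject₁-fromℕ< : ∀ {m n} (m<n : m < n) → fromℕ< (m<n⇒m<1+n m<n) ≡ inject₁ (fromℕ< m<n)
inject₁-fromℕ< {m} m<n = toℕ-injective (begin
  toℕ (fromℕ< (m<n⇒m<1+n m<n)) ≡⟨ toℕ-fromℕ< (m<n⇒m<1+n m<n) ⟩
  m                            ≡⟨ toℕ-fromℕ< m<n ⟨
  toℕ (fromℕ< m<n)             ≡⟨ toℕ-inject₁ (fromℕ< m<n) ⟨
  toℕ (inject₁ (fromℕ< m<n))   ∎)
  where open ≡-Reasoning

∷ᶠ-injective : ∀ {A : Set} {k} {x : A} {f : Fin k → A} →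
  Injective _≡_ _≡_ f → (∀ i → f i ≢ x) → Injective _≡_ _≡_ (x ∷ᶠ f)
∷ᶠ-injective f-inj fresh {Fin.zero}  {Fin.zero}  _  = refl
∷ᶠ-injective f-inj fresh {Fin.zero}  {Fin.suc j} eq = ⊥-elim (fresh j (sym eq))
∷ᶠ-injective f-inj fresh {Fin.suc i} {Fin.zero}  eq = ⊥-elim (fresh i eq)
∷ᶠ-injective f-inj fresh {Fin.suc i} {Fin.suc j} eq = cong Fin.suc (f-inj eq)

even-or-odd : ∀ m → (∃[ i ] m ≡ i + i) ⊎ (∃[ i ] m ≡ suc (i + i))
even-or-odd zero = inj₁ (0 , refl)
even-or-odd (suc m) with even-or-odd m
... | inj₁ (i , refl) = inj₂ (i , refl)
... | inj₂ (i , refl) = inj₁ (suc i , cong suc (sym (+-suc i i)))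

⌊m/2⌋≡i : ∀ {m i} → m ≡ i + i ⊎ m ≡ suc (i + i) → ⌊ m /2⌋ ≡ i
⌊m/2⌋≡i {i = i} (inj₁ refl) = sym (n≡⌊n+n/2⌋ i)
⌊m/2⌋≡i {i = i} (inj₂ refl) = sym (n≡⌈n+n/2⌉ i)

half-≤ : ∀ {m i p} → m ≡ i + i ⊎ m ≡ suc (i + i) → m ≤ suc (p + p) → i ≤ p
half-≤ {p = p} parity le =
  subst₂ _≤_ (⌊m/2⌋≡i parity) (sym (n≡⌈n+n/2⌉ p)) (⌊n/2⌋-mono le)

-- Cycles

toℕ-cycSucc-< : ∀ {k} (i : Fin (suc k)) → toℕ i < k → toℕ (cycSucc i) ≡ suc (toℕ i)
toℕ-cycSucc-< i i<k = trans (toℕ-fromℕ< _) (m<n⇒m%n≡m (s≤s i<k))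

toℕ-cycSucc : ∀ {k} (i : Fin (suc k)) →
  (toℕ i < k × toℕ (cycSucc i) ≡ suc (toℕ i)) ⊎ (toℕ i ≡ k × toℕ (cycSucc i) ≡ 0)
toℕ-cycSucc {k} i with m≤n⇒m<n∨m≡n (s≤s⁻¹ (toℕ<n i))
... | inj₁ i<k = inj₁ (i<k , toℕ-cycSucc-< i i<k)
... | inj₂ i≡k = inj₂ (i≡k , trans (toℕ-fromℕ< _)
                     (trans (cong (λ m → suc m % suc k) i≡k) (n%n≡0 (suc k))))

cycSucc-surjective : ∀ {k} (j : Fin (suc k)) → ∃[ i ] cycSucc i ≡ j
cycSucc-surjective {k} Fin.zero with toℕ-cycSucc (fromℕ k)
... | inj₁ (k<k , _) = ⊥-elim (<-irrefl (toℕ-fromℕ k) k<k)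
... | inj₂ (_ , wraps) = fromℕ k , toℕ-injective wraps
cycSucc-surjective {k} (Fin.suc j) = inject₁ j , toℕ-injective (begin
  toℕ (cycSucc (inject₁ j)) ≡⟨ toℕ-cycSucc-< (inject₁ j) j<k ⟩
  suc (toℕ (inject₁ j))     ≡⟨ cong suc (toℕ-inject₁ j) ⟩
  suc (toℕ j)               ∎)
  where
  open ≡-Reasoning
  j<k : toℕ (inject₁ j) < k
  j<k = subst (_< k) (sym (toℕ-inject₁ j)) (toℕ<n j)

cycSucc²≢id : ∀ {k} → 2 ≤ k → (i : Fin (suc k)) → cycSucc (cycSucc i) ≢ i
cycSucc²≢id {k} 2≤k i eq with toℕ-cycSucc i | toℕ-cycSucc (cycSucc i)
... | inj₁ (_ , s₁) | inj₁ (_ , s₂) =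
  <⇒≢ (m<n⇒m<1+n (n<1+n _)) (trans (sym (cong toℕ eq)) (trans s₂ (cong suc s₁)))
... | inj₁ (_ , s₁) | inj₂ (c≡k , w₂) =
  <⇒≢ 2≤k (sym (trans (sym c≡k) (trans s₁ (cong suc (trans (sym (cong toℕ eq)) w₂)))))
... | inj₂ (i≡k , w₁) | inj₁ (_ , s₂) =
  <⇒≢ 2≤k (sym (trans (sym i≡k) (trans (sym (cong toℕ eq)) (trans s₂ (cong suc w₁)))))
... | inj₂ (_ , w₁) | inj₂ (c≡k , _) = <⇒≢ (≤-trans (s≤s z≤n) 2≤k) (trans (sym w₁) c≡k)

module _ {V : Set} (Adj : V → V → Set) where

  cycle-from-sequence : ∀ {k} (g : ℕ → V) → InjectiveOn (suc k) g →
    (∀ {m} → m < k → Adj (g m) (g (suc m))) → Adj (g k) (g 0) → HasCycle (suc k) Adj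
  cycle-from-sequence {k} g g-inj step close =
    g ∘ toℕ , (λ eq → toℕ-injective (g-inj (toℕ<n _) (toℕ<n _) eq)) , adjacent
    where
    adjacent : ∀ i → Adj (g (toℕ i)) (g (toℕ (cycSucc i)))
    adjacent i with toℕ-cycSucc i
    ... | inj₁ (i<k , next) = subst (Adj (g (toℕ i)) ∘ g) (sym next) (step i<k)
    ... | inj₂ (i≡k , wraps) = subst₂ (λ m m′ → Adj (g m) (g m′)) (sym i≡k) (sym wraps) close

  no-pendant-vertex-on-cycle : Symmetric Adj → ∀ {k} → 2 ≤ k →
    (f : Fin (suc k) → V) → Injective _≡_ _≡_ f → (∀ i → Adj (f i) (f (cycSucc i))) →
    ∀ j z → (∀ t → Adj (f t) (f j) → f t ≡ z) → ⊥
  no-pendant-vertex-on-cycle sym-Adj 2≤k f f-inj adjacent j z pendant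
    with cycSucc-surjective j
  ... | i , refl = cycSucc²≢id 2≤k i (f-inj (trans after (sym before)))
    where
    before : f i ≡ z
    before = pendant i (adjacent i)
    after : f (cycSucc (cycSucc i)) ≡ z
    after = pendant _ (sym-Adj (adjacent (cycSucc i)))

-- Bipartite cycles

interleave : ∀ {A : Set} → (ℕ → A) → (ℕ → A) → ℕ → A
interleave α ν zero          = α 0
interleave α ν (suc zero)    = ν 0
interleave α ν (suc (suc m)) = interleave (α ∘ suc) (ν ∘ suc) m

interleave-even : ∀ {A : Set} (α ν : ℕ → A) i → interleave α ν (i + i) ≡ α i
interleave-even α ν zero = refl
interleave-even α ν (suc i) rewrite +-suc i i = interleave-even (α ∘ suc) (ν ∘ suc) i

interleave-odd : ∀ {A : Set} (α ν : ℕ → A) i → interleave α ν (suc (i + i)) ≡ ν i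
interleave-odd α ν zero = refl
interleave-odd α ν (suc i) rewrite +-suc i i = interleave-odd (α ∘ suc) (ν ∘ suc) i

module _ {n₁ n₂ : ℕ} {E : Fin n₁ → Fin n₂ → Set} where

  BAdj-sym : Symmetric (BAdj E)
  BAdj-sym {inj₁ _} {inj₂ _} e = e
  BAdj-sym {inj₂ _} {inj₁ _} e = e

  BAdj-right-end : ∀ {a b} → BAdj E a b → ∃[ v ] (a ≡ inj₂ v ⊎ b ≡ inj₂ v)
  BAdj-right-end {inj₁ _} {inj₂ v} _ = v , inj₂ refl
  BAdj-right-end {inj₂ v} {inj₁ _} _ = v , inj₁ refl

  interleaved-cycle : ∀ {p} (α : ℕ → Fin n₁) (ν : ℕ → Fin n₂) →
    InjectiveOn (suc p) α → InjectiveOn (suc p) ν →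
    (∀ {i} → i ≤ p → E (α i) (ν i)) → (∀ {i} → i < p → E (α (suc i)) (ν i)) → E (α 0) (ν p) →
    HasCycle (suc p + suc p) (BAdj E)
  interleaved-cycle {p} α ν α-inj ν-inj αν να close =
    subst (λ r → HasCycle r (BAdj E)) (cong suc (sym (+-suc p p)))
      (cycle-from-sequence (BAdj E) g g-inj step (subst₂ (BAdj E) (g-odd p) refl close))
    where
    g : ℕ → Vtx n₁ n₂
    g = interleave (inj₁ ∘ α) (inj₂ ∘ ν)
    g-even : ∀ i → inj₁ (α i) ≡ g (i + i)
    g-even i = sym (interleave-even (inj₁ ∘ α) (inj₂ ∘ ν) i)
    g-odd : ∀ i → inj₂ (ν i) ≡ g (suc (i + i))
    g-odd i = sym (interleave-odd (inj₁ ∘ α) (inj₂ ∘ ν) i)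

    g-inj : InjectiveOn (suc (suc (p + p))) g
    g-inj {m} {m′} m< m′< eq with even-or-odd m | even-or-odd m′
    ... | inj₁ (i , refl) | inj₁ (i′ , refl) = cong (λ j → j + j)
      (α-inj (s≤s (half-≤ (inj₁ refl) (s≤s⁻¹ m<))) (s≤s (half-≤ (inj₁ refl) (s≤s⁻¹ m′<)))
        (inj₁-injective (trans (g-even i) (trans eq (sym (g-even i′))))))
    ... | inj₂ (i , refl) | inj₂ (i′ , refl) = cong (λ j → suc (j + j))
      (ν-inj (s≤s (half-≤ (inj₂ refl) (s≤s⁻¹ m<))) (s≤s (half-≤ (inj₂ refl) (s≤s⁻¹ m′<)))
        (inj₂-injective (trans (g-odd i) (trans eq (sym (g-odd i′))))))
    ... | inj₁ (i , refl) | inj₂ (i′ , refl) =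
      contradiction (trans (g-even i) (trans eq (sym (g-odd i′)))) λ ()
    ... | inj₂ (i , refl) | inj₁ (i′ , refl) =
      contradiction (trans (g-odd i) (trans eq (sym (g-even i′)))) λ ()

    step : ∀ {m} → m < suc (p + p) → BAdj E (g m) (g (suc m))
    step {m} m< with even-or-odd m
    ... | inj₁ (i , refl) = subst₂ (BAdj E) (g-even i) (g-odd i) (αν (half-≤ (inj₁ refl) (<⇒≤ m<)))
    ... | inj₂ (i , refl) =
      subst₂ (BAdj E) (g-odd i) (sym (interleave-even (inj₁ ∘ α ∘ suc) (inj₂ ∘ ν ∘ suc) i))
        (να (half-≤ (inj₁ (cong suc (sym (+-suc i i)))) m<))

  alternating-cycle : ∀ {p} (α : Fin (suc p) → Fin n₁) (ν : Fin (suc p) → Fin n₂) →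
    Injective _≡_ _≡_ α → Injective _≡_ _≡_ ν →
    (∀ i → E (α i) (ν i)) → (∀ i → E (α (Fin.suc i)) (ν (inject₁ i))) →
    E (α Fin.zero) (ν (fromℕ p)) →
    HasCycle (suc p + suc p) (BAdj E)
  alternating-cycle {p} α ν α-inj ν-inj αν να close =
    interleaved-cycle (extend α) (extend ν) (extend-injectiveOn α-inj) (extend-injectiveOn ν-inj)
      (λ i≤p → subst₂ E (sym (extend-< α (s≤s i≤p))) (sym (extend-< ν (s≤s i≤p))) (αν _))
      (λ i<p → subst₂ E (sym (extend-< α (s≤s i<p)))
                 (sym (trans (extend-< ν (m<n⇒m<1+n i<p)) (cong ν (inject₁-fromℕ< i<p))))
                 (να (fromℕ< i<p)))
      (subst₂ E (sym (extend-< α (s≤s z≤n)))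
        (sym (trans (extend-< ν (n<1+n p)) (cong ν (sym (fromℕ-def p))))) close)

  cycle-right-vertices : ∀ m (C : HasCycle (m + m) (BAdj E)) →
    Σ (Fin m → Fin n₂) λ φ → Injective _≡_ _≡_ φ × (∀ j → ∃[ t ] proj₁ C t ≡ inj₂ (φ j))
  cycle-right-vertices zero _ = (λ ()) , (λ { {()} }) , (λ ())
  cycle-right-vertices (suc m) (f , f-inj , adjacent) =
    φ , φ-inj , λ j → proj₁ (right-end j) , proj₂ (proj₂ (proj₂ (right-end j)))
    where
    within : ∀ (j : Fin (suc m)) → suc (toℕ j + toℕ j) < suc m + suc m
    within j = s≤s (≤-trans (s≤s (+-mono-≤ j≤m j≤m)) (+-monoʳ-< m (n<1+n m)))
      where j≤m = s≤s⁻¹ (toℕ<n j)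

    even odd : Fin (suc m) → Fin (suc m + suc m)
    even j = fromℕ< (<⇒≤ (within j))
    odd j = fromℕ< (within j)

    edge : ∀ j → BAdj E (f (even j)) (f (odd j))
    edge j = subst (BAdj E (f (even j)) ∘ f) (toℕ-injective (begin
      toℕ (cycSucc (even j)) ≡⟨ toℕ-cycSucc-< (even j) even<k ⟩
      suc (toℕ (even j))     ≡⟨ cong suc (toℕ-fromℕ< _) ⟩
      suc (toℕ j + toℕ j)    ≡⟨ toℕ-fromℕ< (within j) ⟨
      toℕ (odd j)            ∎)) (adjacent (even j))
      where
      open ≡-Reasoning
      even<k : toℕ (even j) < m + suc m
      even<k = subst (_< m + suc m) (sym (toℕ-fromℕ< _)) (s≤s⁻¹ (within j))

    -- Each φ j is a right end of the edge between positions 2j and 2j + 1; these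
    -- edges are disjoint, which makes φ injective.
    right-end : ∀ j → Σ (Fin (suc m + suc m)) λ t →
      (toℕ t ≡ toℕ j + toℕ j ⊎ toℕ t ≡ suc (toℕ j + toℕ j)) × ∃[ v ] f t ≡ inj₂ v
    right-end j with BAdj-right-end (edge j)
    ... | v , inj₁ e = even j , inj₁ (toℕ-fromℕ< (<⇒≤ (within j))) , v , e
    ... | v , inj₂ o = odd j , inj₂ (toℕ-fromℕ< (within j)) , v , o

    φ : Fin (suc m) → Fin n₂
    φ j = proj₁ (proj₂ (proj₂ (right-end j)))

    φ-inj : Injective _≡_ _≡_ φ
    φ-inj {j} {j′} eq with right-end j | right-end j′
    ... | t , t≈j , _ , ft | t′ , t′≈j′ , _ , ft′ = toℕ-injective (begin
      toℕ j         ≡⟨ ⌊m/2⌋≡i t≈j ⟨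
      ⌊ toℕ t /2⌋   ≡⟨ cong (⌊_/2⌋ ∘ toℕ) (f-inj (trans ft (trans (cong inj₂ eq) (sym ft′)))) ⟩
      ⌊ toℕ t′ /2⌋  ≡⟨ ⌊m/2⌋≡i t′≈j′ ⟩
      toℕ j′        ∎)
      where open ≡-Reasoning

-- Listing the elements of a subset

x∉p-x : ∀ {n} (p : Subset n) x → x ∉ p - x
x∉p-x (_ ∷ p) Fin.zero    ()
x∉p-x (_ ∷ p) (Fin.suc x) (there x∈p-x) = x∉p-x p x x∈p-x

x∈p-y⇒x≢y : ∀ {n} {p : Subset n} {x y} → x ∈ p - y → x ≢ y
x∈p-y⇒x≢y {p = p} x∈p-x refl = x∉p-x p _ x∈p-x

p-x⊆p : ∀ {n} {p : Subset n} {x} → p - x ⊆ p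
p-x⊆p {p = p} {x} = p─q⊆p p ⁅ x ⁆

x∈p⇒∣p∣≡1+∣p-x∣ : ∀ {n} {p : Subset n} {x} → x ∈ p → ∣ p ∣ ≡ suc ∣ p - x ∣
x∈p⇒∣p∣≡1+∣p-x∣ {p = inside ∷ p} here = cong (suc ∘ ∣_∣) (sym (p─⊥≡p p))
x∈p⇒∣p∣≡1+∣p-x∣ {p = inside ∷ p} (there x∈p) = cong suc (x∈p⇒∣p∣≡1+∣p-x∣ x∈p)
x∈p⇒∣p∣≡1+∣p-x∣ {p = outside ∷ p} (there x∈p) = x∈p⇒∣p∣≡1+∣p-x∣ x∈p

x∈p⇒k≤∣p-x∣ : ∀ {n} {p : Subset n} {x k} → x ∈ p → suc k ≤ ∣ p ∣ → k ≤ ∣ p - x ∣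
x∈p⇒k≤∣p-x∣ x∈p 1+k≤∣p∣ = s≤s⁻¹ (subst (_ ≤_) (x∈p⇒∣p∣≡1+∣p-x∣ x∈p) 1+k≤∣p∣)

rank : ∀ {n} {p : Subset n} {x} → x ∈ p → Fin ∣ p ∣
rank {p = inside ∷ _}  here          = Fin.zero
rank {p = inside ∷ _}  (there x∈p)   = Fin.suc (rank x∈p)
rank {p = outside ∷ _} (there x∈p)   = rank x∈p

rank-injective : ∀ {n} {p : Subset n} {x y} (x∈p : x ∈ p) (y∈p : y ∈ p) →
  rank x∈p ≡ rank y∈p → x ≡ y
rank-injective {p = inside ∷ _}  here      here      _  = refl
rank-injective {p = inside ∷ _}  (there a) (there b) eq =
  cong Fin.suc (rank-injective a b (suc-injective eq))
rank-injective {p = outside ∷ _} (there a) (there b) eq = cong Fin.suc (rank-injective a b eq)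

record Listing {n} (p : Subset n) (k : ℕ) : Set where
  field
    at        : Fin k → Fin n
    injective : Injective _≡_ _≡_ at
    at∈       : ∀ i → at i ∈ p
open Listing

module _ {n : ℕ} where

  Listing⇒≤∣p∣ : ∀ {p : Subset n} {k} → Listing p k → k ≤ ∣ p ∣
  Listing⇒≤∣p∣ L = injective⇒≤ (λ eq → injective L (rank-injective (at∈ L _) (at∈ L _) eq))

  listing-⊆ : ∀ {p q : Subset n} {k} → p ⊆ q → Listing p k → Listing q k
  listing-⊆ p⊆q L = record { at = at L ; injective = injective L ; at∈ = p⊆q ∘ at∈ L }

  cons : ∀ {p : Subset n} {x k} → x ∈ p → Listing (p - x) k → Listing p (suc k)
  cons {x = x} x∈p L = record
    { at        = x ∷ᶠ at L
    ; injective = ∷ᶠ-injective (injective L) (x∈p-y⇒x≢y ∘ at∈ L)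
    ; at∈       = λ { Fin.zero → x∈p ; (Fin.suc i) → p-x⊆p (at∈ L i) }
    }

listing-all : ∀ {n} (p : Subset n) → Listing p ∣ p ∣
listing-all [] = record { at = λ () ; injective = λ { {()} } ; at∈ = λ () }
listing-all (inside ∷ p) = record
  { at        = Fin.zero ∷ᶠ (Fin.suc ∘ at L)
  ; injective = ∷ᶠ-injective (injective L ∘ suc-injective) (λ _ ())
  ; at∈       = λ { Fin.zero → here ; (Fin.suc i) → there (at∈ L i) }
  }
  where L = listing-all p
listing-all (outside ∷ p) = record
  { at        = Fin.suc ∘ at L
  ; injective = injective L ∘ suc-injective
  ; at∈       = there ∘ at∈ L
  }
  where L = listing-all p

listing : ∀ {n} {p : Subset n} {k} → k ≤ ∣ p ∣ → Listing p k
listing {p = p} k≤∣p∣ = record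
  { at        = λ i → at L (inject≤ i k≤∣p∣)
  ; injective = λ eq → inject≤-injective k≤∣p∣ k≤∣p∣ _ _ (injective L eq)
  ; at∈       = λ i → at∈ L (inject≤ i k≤∣p∣)
  }
  where L = listing-all p

-- The graph 𝒢

module 𝒢-Properties {n₁ n₂} (A₁ : Subset n₁) (A₂ : Subset n₂) (x₁ x₂ : Fin n₁) (y₁ : Fin n₂)
         (x₁∉A₁ : x₁ ∉ A₁) (x₂∉A₁ : x₂ ∉ A₁) (y₁∉A₂ : y₁ ∉ A₂) where

  private
    E : Fin n₁ → Fin n₂ → Set
    E = 𝒢 A₁ A₂ x₁ x₂ y₁

  A₁-neighbour : ∀ {a w} → a ∈ A₁ → BAdj E w (inj₁ a) → w ≡ inj₂ y₁
  A₁-neighbour {w = inj₂ _} _   (inj₁ (_ , refl))                 = refl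
  A₁-neighbour {w = inj₂ _} a∈A₁ (inj₂ (inj₁ (_ , refl)))          = ⊥-elim (x₁∉A₁ a∈A₁)
  A₁-neighbour {w = inj₂ _} a∈A₁ (inj₂ (inj₂ (inj₁ (refl , _))))   = ⊥-elim (x₂∉A₁ a∈A₁)
  A₁-neighbour {w = inj₂ _} a∈A₁ (inj₂ (inj₂ (inj₂ (a∉A₁ , _))))  = ⊥-elim (a∉A₁ a∈A₁)

  A₂-neighbour : ∀ {b w} → b ∈ A₂ → BAdj E w (inj₂ b) → w ≡ inj₁ x₁
  A₂-neighbour {w = inj₁ _} b∈A₂ (inj₁ (_ , refl))                   = ⊥-elim (y₁∉A₂ b∈A₂)
  A₂-neighbour {w = inj₁ _} _    (inj₂ (inj₁ (_ , refl)))            = refl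
  A₂-neighbour {w = inj₁ _} b∈A₂ (inj₂ (inj₂ (inj₁ (_ , refl))))     = ⊥-elim (y₁∉A₂ b∈A₂)
  A₂-neighbour {w = inj₁ _} b∈A₂ (inj₂ (inj₂ (inj₂ (_ , b∉A₂ , _)))) = ⊥-elim (b∉A₂ b∈A₂)

  y₁-neighbour : ∀ {w} → BAdj E w (inj₂ y₁) → w ≡ inj₁ x₂ ⊎ ∃[ a ] a ∈ A₁ × w ≡ inj₁ a
  y₁-neighbour {inj₁ a} (inj₁ (a∈A₁ , _))                   = inj₂ (a , a∈A₁ , refl)
  y₁-neighbour {inj₁ _} (inj₂ (inj₁ (y₁∈A₂ , _)))           = ⊥-elim (y₁∉A₂ y₁∈A₂)
  y₁-neighbour {inj₁ _} (inj₂ (inj₂ (inj₁ (refl , _))))     = inj₁ refl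
  y₁-neighbour {inj₁ _} (inj₂ (inj₂ (inj₂ (_ , _ , y₁≢y₁)))) = ⊥-elim (y₁≢y₁ refl)

  module _ {k} (2≤k : 2 ≤ k) (f : Fin (suc k) → Vtx n₁ n₂) (f-inj : Injective _≡_ _≡_ f)
           (adjacent : ∀ i → BAdj E (f i) (f (cycSucc i))) where

    private
      pendant-free : ∀ j z → (∀ t → BAdj E (f t) (f j) → f t ≡ z) → ⊥
      pendant-free =
        no-pendant-vertex-on-cycle (BAdj E) (λ {a} {b} → BAdj-sym {E = E} {a} {b}) 2≤k f f-inj adjacent

    cycle-avoids-A₁ : ∀ t {a} → f t ≡ inj₁ a → a ∉ A₁
    cycle-avoids-A₁ t ft a∈A₁ =
      pendant-free t (inj₂ y₁) λ s adj → A₁-neighbour a∈A₁ (subst (BAdj E (f s)) ft adj)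

    cycle-avoids-A₂ : ∀ t {b} → f t ≡ inj₂ b → b ∉ A₂
    cycle-avoids-A₂ t ft b∈A₂ =
      pendant-free t (inj₁ x₁) λ s adj → A₂-neighbour b∈A₂ (subst (BAdj E (f s)) ft adj)

    cycle-avoids-y₁ : ∀ t → f t ≢ inj₂ y₁
    cycle-avoids-y₁ t ft = pendant-free t (inj₁ x₂) λ s adj →
      [ id , (λ { (a , a∈A₁ , fs) → ⊥-elim (cycle-avoids-A₁ s fs a∈A₁) }) ]′
        (y₁-neighbour (subst (BAdj E (f s)) ft adj))

  𝒢-C₂ℓ-free : ∀ ℓ → 2 ≤ ℓ → ∣ ∁ A₂ ∣ ≤ ℓ → ¬ HasCycle (ℓ + ℓ) (BAdj E)
  𝒢-C₂ℓ-free (suc p) 2≤ℓ ∣B₂∣≤ℓ C@(f , f-inj , adjacent)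
    with cycle-right-vertices (suc p) C
  ... | φ , φ-inj , on-cycle =
    1+n≰n (≤-trans (Listing⇒≤∣p∣ (cons (x∉p⇒x∈∁p y₁∉A₂) right-vertices)) ∣B₂∣≤ℓ)
    where
    2≤k : 2 ≤ p + suc p
    2≤k = ≤-trans 2≤ℓ (m≤n+m (suc p) p)

    right-vertices : Listing (∁ A₂ - y₁) (suc p)
    right-vertices = record
      { at        = φ
      ; injective = φ-inj
      ; at∈       = λ j → let t , ft = on-cycle j in
          x∈p∧x≢y⇒x∈p-y (x∉p⇒x∈∁p (cycle-avoids-A₂ 2≤k f f-inj adjacent t ft))
                        (cycle-avoids-y₁ 2≤k f f-inj adjacent t ∘ trans ft ∘ cong inj₂)
      }

  module _ (q : ℕ) (x₁≢x₂ : x₁ ≢ x₂)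
           (ℓ≤∣B₁∣ : 3 + q ≤ ∣ ∁ A₁ ∣) (ℓ≤∣B₂∣ : 3 + q ≤ ∣ ∁ A₂ ∣) where

    private
      ℓ : ℕ
      ℓ = 3 + q

      B₁ : Subset n₁
      B₁ = ∁ A₁

      B₂ : Subset n₂
      B₂ = ∁ A₂

      C₂ℓ-after-adding : Fin n₁ → Fin n₂ → Set
      C₂ℓ-after-adding u v = HasCycle (ℓ + ℓ) (BAdj (addEdge E u v))

      B-edge : ∀ {a b} → a ∈ B₁ → b ∈ B₂ - y₁ → E a b
      B-edge a∈B₁ b∈B₂-y₁ =
        inj₂ (inj₂ (inj₂ (x∈∁p⇒x∉p a∈B₁ , x∈∁p⇒x∉p (p-x⊆p b∈B₂-y₁) , x∈p-y⇒x≢y b∈B₂-y₁)))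

      y₁∈B₂ : y₁ ∈ B₂
      y₁∈B₂ = x∉p⇒x∈∁p y₁∉A₂

    -- The cycle u w a, then alternately through B₂ ∖ {y₁} and B₁, back to u.
    cycle-via-B₁ : ∀ {u w a} → u ∈ B₁ → a ∈ B₁ - u → w ∉ B₂ - y₁ → E a w → C₂ℓ-after-adding u w
    cycle-via-B₁ {u} {w} {a} u∈B₁ a∈B₁-u w∉B₂-y₁ aw =
      alternating-cycle (at α) (w ∷ᶠ at ν) (injective α)
        (∷ᶠ-injective (injective ν) (λ i eq → w∉B₂-y₁ (subst (_∈ B₂ - y₁) eq (at∈ ν i))))
        αν να (inj₁ (B-edge u∈B₁ (at∈ ν (fromℕ (suc q)))))
      where
      α : Listing B₁ ℓ
      α = cons u∈B₁ (cons a∈B₁-u (listing (x∈p⇒k≤∣p-x∣ a∈B₁-u (x∈p⇒k≤∣p-x∣ u∈B₁ ℓ≤∣B₁∣))))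
      ν : Listing (B₂ - y₁) (2 + q)
      ν = listing (x∈p⇒k≤∣p-x∣ y₁∈B₂ ℓ≤∣B₂∣)
      αν : ∀ i → addEdge E u w (at α i) ((w ∷ᶠ at ν) i)
      αν Fin.zero    = inj₂ (refl , refl)
      αν (Fin.suc i) = inj₁ (B-edge (at∈ α (Fin.suc i)) (at∈ ν i))
      να : ∀ i → addEdge E u w (at α (Fin.suc i)) ((w ∷ᶠ at ν) (inject₁ i))
      να Fin.zero    = inj₁ aw
      να (Fin.suc i) = inj₁ (B-edge (at∈ α (Fin.suc (Fin.suc i))) (at∈ ν (inject₁ i)))

    -- The cycle x₂ y₁ u v α₀ ν₀ α₁ ν₁ …, back to x₂.
    cycle-via-A₁ : ∀ {u v} → u ∈ A₁ → v ≢ y₁ → (α : Listing (B₁ - x₂) (suc q)) →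
      (ν : Listing (B₂ - y₁ - v) (suc q)) → E (at α Fin.zero) v → C₂ℓ-after-adding u v
    cycle-via-A₁ {u} {v} u∈A₁ v≢y₁ α ν α₀v =
      alternating-cycle (x₂ ∷ᶠ u ∷ᶠ at α) (y₁ ∷ᶠ v ∷ᶠ at ν)
        (∷ᶠ-injective (∷ᶠ-injective (injective α) (u-fresh ∘ at∈ α)) x₂-fresh)
        (∷ᶠ-injective (∷ᶠ-injective (injective ν) (x∈p-y⇒x≢y ∘ at∈ ν)) y₁-fresh)
        αν να (inj₁ (B-edge x₂∈B₁ (p-x⊆p (at∈ ν (fromℕ q)))))
      where
      x₂∈B₁ : x₂ ∈ B₁
      x₂∈B₁ = x∉p⇒x∈∁p x₂∉A₁
      u-fresh : ∀ {a} → a ∈ B₁ - x₂ → a ≢ u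
      u-fresh a∈B₁-x₂ refl = x∈∁p⇒x∉p (p-x⊆p a∈B₁-x₂) u∈A₁
      x₂-fresh : ∀ i → (u ∷ᶠ at α) i ≢ x₂
      x₂-fresh Fin.zero    refl = x₂∉A₁ u∈A₁
      x₂-fresh (Fin.suc i)      = x∈p-y⇒x≢y (at∈ α i)
      y₁-fresh : ∀ i → (v ∷ᶠ at ν) i ≢ y₁
      y₁-fresh Fin.zero    = v≢y₁
      y₁-fresh (Fin.suc i) = x∈p-y⇒x≢y (p-x⊆p (at∈ ν i))
      αν : ∀ i → addEdge E u v ((x₂ ∷ᶠ u ∷ᶠ at α) i) ((y₁ ∷ᶠ v ∷ᶠ at ν) i)
      αν Fin.zero              = inj₁ (inj₂ (inj₂ (inj₁ (refl , refl))))
      αν (Fin.suc Fin.zero)    = inj₂ (refl , refl)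
      αν (Fin.suc (Fin.suc i)) = inj₁ (B-edge (p-x⊆p (at∈ α i)) (p-x⊆p (at∈ ν i)))
      να : ∀ i → addEdge E u v ((u ∷ᶠ at α) i) ((y₁ ∷ᶠ v ∷ᶠ at ν) (inject₁ i))
      να Fin.zero              = inj₁ (inj₁ (u∈A₁ , refl))
      να (Fin.suc Fin.zero)    = inj₁ α₀v
      να (Fin.suc (Fin.suc i)) =
        inj₁ (B-edge (p-x⊆p (at∈ α (Fin.suc i))) (p-x⊆p (at∈ ν (inject₁ i))))

    add-A₁-A₂ : ∀ {u v} → u ∈ A₁ → v ∈ A₂ → C₂ℓ-after-adding u v
    add-A₁-A₂ {v = v} u∈A₁ v∈A₂ =
      cycle-via-A₁ u∈A₁ (λ { refl → y₁∉A₂ v∈A₂ })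
        (cons x₁∈B₁-x₂ (listing (≤-trans (n≤1+n q) (x∈p⇒k≤∣p-x∣ x₁∈B₁-x₂
          (x∈p⇒k≤∣p-x∣ (x∉p⇒x∈∁p x₂∉A₁) ℓ≤∣B₁∣)))))
        (listing-⊆ (λ b∈B₂-y₁ → x∈p∧x≢y⇒x∈p-y b∈B₂-y₁ λ { refl → x∈∁p⇒x∉p (p-x⊆p b∈B₂-y₁) v∈A₂ })
          (listing (≤-trans (n≤1+n (suc q)) (x∈p⇒k≤∣p-x∣ y₁∈B₂ ℓ≤∣B₂∣))))
        (inj₂ (inj₁ (v∈A₂ , refl)))
      where
      x₁∈B₁-x₂ : x₁ ∈ B₁ - x₂
      x₁∈B₁-x₂ = x∈p∧x≢y⇒x∈p-y (x∉p⇒x∈∁p x₁∉A₁) x₁≢x₂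

    add-A₁-B₂ : ∀ {u v} → u ∈ A₁ → v ∈ B₂ - y₁ → C₂ℓ-after-adding u v
    add-A₁-B₂ u∈A₁ v∈B₂-y₁ =
      cycle-via-A₁ u∈A₁ (x∈p-y⇒x≢y v∈B₂-y₁) α
        (listing (x∈p⇒k≤∣p-x∣ v∈B₂-y₁ (x∈p⇒k≤∣p-x∣ y₁∈B₂ ℓ≤∣B₂∣)))
        (B-edge (p-x⊆p (at∈ α Fin.zero)) v∈B₂-y₁)
      where
      α : Listing (B₁ - x₂) (suc q)
      α = listing (≤-trans (n≤1+n (suc q)) (x∈p⇒k≤∣p-x∣ (x∉p⇒x∈∁p x₂∉A₁) ℓ≤∣B₁∣))

    add-B₁-A₂ : ∀ {u v} → u ∈ B₁ → u ≢ x₁ → v ∈ A₂ → C₂ℓ-after-adding u v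
    add-B₁-A₂ u∈B₁ u≢x₁ v∈A₂ =
      cycle-via-B₁ u∈B₁ (x∈p∧x≢y⇒x∈p-y (x∉p⇒x∈∁p x₁∉A₁) (u≢x₁ ∘ sym))
        (λ v∈B₂-y₁ → x∈∁p⇒x∉p (p-x⊆p v∈B₂-y₁) v∈A₂) (inj₂ (inj₁ (v∈A₂ , refl)))

    add-B₁-y₁ : ∀ {u} → u ∈ B₁ → u ≢ x₂ → C₂ℓ-after-adding u y₁
    add-B₁-y₁ u∈B₁ u≢x₂ =
      cycle-via-B₁ u∈B₁ (x∈p∧x≢y⇒x∈p-y (x∉p⇒x∈∁p x₂∉A₁) (u≢x₂ ∘ sym))
        (x∉p-x B₂ y₁) (inj₂ (inj₂ (inj₁ (refl , refl))))

    𝒢+uv-has-C₂ℓ : ∀ u v → ¬ E u v → C₂ℓ-after-adding u v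
    𝒢+uv-has-C₂ℓ u v ¬uv with u ∈? A₁ | v ∈? A₂
    ... | yes u∈A₁ | yes v∈A₂ = add-A₁-A₂ u∈A₁ v∈A₂
    ... | yes u∈A₁ | no v∉A₂ with v Fin.≟ y₁
    ...   | yes refl = ⊥-elim (¬uv (inj₁ (u∈A₁ , refl)))
    ...   | no v≢y₁  = add-A₁-B₂ u∈A₁ (x∈p∧x≢y⇒x∈p-y (x∉p⇒x∈∁p v∉A₂) v≢y₁)
    𝒢+uv-has-C₂ℓ u v ¬uv | no u∉A₁ | yes v∈A₂ with u Fin.≟ x₁
    ...   | yes refl = ⊥-elim (¬uv (inj₂ (inj₁ (v∈A₂ , refl))))
    ...   | no u≢x₁  = add-B₁-A₂ (x∉p⇒x∈∁p u∉A₁) u≢x₁ v∈A₂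
    𝒢+uv-has-C₂ℓ u v ¬uv | no u∉A₁ | no v∉A₂ with v Fin.≟ y₁
    ...   | no v≢y₁  = ⊥-elim (¬uv (inj₂ (inj₂ (inj₂ (u∉A₁ , v∉A₂ , v≢y₁)))))
    ...   | yes refl with u Fin.≟ x₂
    ...     | yes refl = ⊥-elim (¬uv (inj₂ (inj₂ (inj₁ (refl , refl)))))
    ...     | no u≢x₂  = add-B₁-y₁ (x∉p⇒x∈∁p u∉A₁) u≢x₂

∣p∣≡n∸ℓ⇒∣∁p∣≡ℓ : ∀ {n ℓ} (p : Subset n) → ℓ ≤ n → ∣ p ∣ ≡ n ∸ ℓ → ∣ ∁ p ∣ ≡ ℓ
∣p∣≡n∸ℓ⇒∣∁p∣≡ℓ {n} {ℓ} p ℓ≤n ∣p∣≡n∸ℓ = begin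
  ∣ ∁ p ∣      ≡⟨ ∣∁p∣≡n∸∣p∣ p ⟩
  n ∸ ∣ p ∣    ≡⟨ cong (n ∸_) ∣p∣≡n∸ℓ ⟩
  n ∸ (n ∸ ℓ)  ≡⟨ m∸[m∸n]≡n ℓ≤n ⟩
  ℓ            ∎
  where open ≡-Reasoning

proposition2p3 : (ℓ n₁ n₂ : ℕ) → 3 ≤ ℓ → ℓ + 2 ≤ n₁ → ℓ + 2 ≤ n₂ →
    (A₁ : Subset n₁) (A₂ : Subset n₂) → ∣ A₁ ∣ ≡ n₁ ∸ ℓ → ∣ A₂ ∣ ≡ n₂ ∸ ℓ →
    (x₁ x₂ : Fin n₁) (y₁ : Fin n₂) → x₁ ≢ x₂ → x₁ ∉ A₁ → x₂ ∉ A₁ → y₁ ∉ A₂ →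
    CycleSaturatedInK (2 * ℓ) (𝒢 A₁ A₂ x₁ x₂ y₁)
proposition2p3 _ n₁ n₂ (s≤s (s≤s (s≤s {n = q} z≤n))) ℓ+2≤n₁ ℓ+2≤n₂ A₁ A₂ ∣A₁∣≡n₁∸ℓ ∣A₂∣≡n₂∸ℓ
               x₁ x₂ y₁ x₁≢x₂ x₁∉A₁ x₂∉A₁ y₁∉A₂ =
  subst (λ r → CycleSaturatedInK r (𝒢 A₁ A₂ x₁ x₂ y₁)) (cong (ℓ +_) (sym (+-identityʳ ℓ)))
    ( 𝒢-C₂ℓ-free ℓ (s≤s (s≤s z≤n)) (≤-reflexive ∣B₂∣≡ℓ)
    , 𝒢+uv-has-C₂ℓ q x₁≢x₂ (≤-reflexive (sym ∣B₁∣≡ℓ)) (≤-reflexive (sym ∣B₂∣≡ℓ)) )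
  where
  open 𝒢-Properties A₁ A₂ x₁ x₂ y₁ x₁∉A₁ x₂∉A₁ y₁∉A₂
  ℓ : ℕ
  ℓ = 3 + q
  ∣B₁∣≡ℓ : ∣ ∁ A₁ ∣ ≡ ℓ
  ∣B₁∣≡ℓ = ∣p∣≡n∸ℓ⇒∣∁p∣≡ℓ A₁ (m+n≤o⇒m≤o ℓ ℓ+2≤n₁) ∣A₁∣≡n₁∸ℓ
  ∣B₂∣≡ℓ : ∣ ∁ A₂ ∣ ≡ ℓ
  ∣B₂∣≡ℓ = ∣p∣≡n∸ℓ⇒∣∁p∣≡ℓ A₂ (m+n≤o⇒m≤o ℓ ℓ+2≤n₂) ∣A₂∣≡n₂∸ℓ
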